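{- Let $G$ be a finite simple graph with $\alpha(G)=2$, let $xy$ be a dominating edge of $G$, and let $z$ be a vertex of $G$ distinct from $x$ and $y$. Then there is an extension of $\overline{N[z]}$ containing both $x$ and $y$ if and only if one of the following holds: (i) $zx$ is a dominating edge and $z$ is not adjacent to $y$; (ii) $zy$ is a dominating edge and $z$ is not adjacent to $x$; (iii) $zx$ and $zy$ are both dominating edges.
   Context: $\overline{N[z]}$ denotes the set of vertices of $G$ different from $z$ and not adjacent to $z$ (a clique since $\alpha(G)=2$). An extension of $\overline{N[z]}$ is a clique of $G$ of the form $\overline{N[z]}\cup S$ where $S$ is a set of neighbours of $z$. An edge $ab$ is dominating if every vertex of $G$ other than $a,b$ is adjacent to at least one of $a,b$. -}

module Defs where

open import Data.Nat using (ℕ)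
open import Data.Fin using (Fin)
open import Data.Fin.Subset using (Subset; _∈_; _⊆_)
open import Data.Product using (Σ; _×_; ∃)
open import Data.Sum using (_⊎_)
open import Relation.Nullary using (¬_; Dec)
open import Relation.Binary.PropositionalEquality using (_≡_; _≢_)
open import Level using (0ℓ)

record Graph (n : ℕ) : Set₁ where
  field
    Adj     : Fin n → Fin n → Set
    sym     : ∀ {u v} → Adj u v → Adj v u
    irrefl  : ∀ {u} → ¬ Adj u u
    adj?    : ∀ u v → Dec (Adj u v)

module _ {n : ℕ} (G : Graph n) where
  open Graph G

  Independent3 : Fin n → Fin n → Fin n → Set
  Independent3 a b c =
    a ≢ b × a ≢ c × b ≢ c × ¬ Adj a b × ¬ Adj a c × ¬ Adj b c

  Alpha2 : Set
  Alpha2 = (Σ (Fin n) λ a → Σ (Fin n) λ b → a ≢ b × ¬ Adj a b)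
         × (∀ a b c → ¬ Independent3 a b c)

  IsClique : (Fin n → Set) → Set
  IsClique C = ∀ u v → C u → C v → u ≢ v → Adj u v

  DominatingEdge : Fin n → Fin n → Set
  DominatingEdge a b =
    Adj a b × (∀ v → v ≢ a → v ≢ b → Adj a v ⊎ Adj b v)

  NonNbhd : Fin n → Fin n → Set
  NonNbhd z v = v ≢ z × ¬ Adj z v

  ExtSet : Fin n → Subset n → Fin n → Set
  ExtSet z S v = NonNbhd z v ⊎ v ∈ S

  IsExtension : Fin n → Subset n → Set
  IsExtension z S = (∀ v → v ∈ S → Adj z v) × IsClique (ExtSet z S)

{-# OPTIONS --safe #-}
-- Since α(G) = 2, the non-neighbourhood of z is a clique, so a set S of
-- neighbours of z extends it exactly when S is a clique all of whose members
-- are adjacent to every non-neighbour of z, i.e. dominate together with z.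
-- The dominating edge xy forces z to be adjacent to x or to y, and x, y are
-- adjacent; hence an extension containing x and y exists iff each of x, y
-- that is adjacent to z forms a dominating edge with z, which is what the
-- three cases (i)–(iii) spell out.
module Submission where

open import Defs
open import Data.Nat using (ℕ)
open import Data.Fin using (Fin; _≟_)
open import Data.Fin.Subset using (Subset; _∈_)
open import Data.Product using (Σ; _×_; _,_; proj₁)
open import Data.Sum using (_⊎_; inj₁; inj₂; [_,_]′) renaming (map to ⊎-map)
open import Data.Empty using (⊥-elim)
open import Data.Bool using (true)
open import Data.Vec using (tabulate)
open import Data.Vec.Properties using (lookup∘tabulate; []=⇒lookup; lookup⇒[]=)
open import Function using (_∘_)
open import Relation.Nullary using (¬_; Dec; yes; no; does; proof)
open import Relation.Nullary.Decidable using (dec-true; _×-dec_; _⊎-dec_)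
open import Relation.Nullary.Reflects using (Reflects; invert)
open import Relation.Binary.PropositionalEquality using (_≢_; _≡_; refl; sym; trans; subst; ≢-sym)
open import Function.Bundles using (_⇔_; mk⇔)
import Function.Properties.Equivalence as ⇔

module _ {n : ℕ} {P : Fin n → Set} (P? : ∀ v → Dec (P v)) where

  subsetOf : Subset n
  subsetOf = tabulate (does ∘ P?)

  ∈-subsetOf⁺ : ∀ {v} → P v → v ∈ subsetOf
  ∈-subsetOf⁺ {v} p =
    lookup⇒[]= v subsetOf (trans (lookup∘tabulate (does ∘ P?) v) (dec-true (P? v) p))

  ∈-subsetOf⁻ : ∀ {v} → v ∈ subsetOf → P v
  ∈-subsetOf⁻ {v} v∈ = invert (subst (Reflects (P v)) does≡true (proof (P? v)))
    where
    does≡true : does (P? v) ≡ true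
    does≡true = trans (sym (lookup∘tabulate (does ∘ P?) v)) ([]=⇒lookup v∈)

module _ {n : ℕ} (G : Graph n) where
  open Graph G renaming (sym to adj-sym)

  nonNbhd-isClique : (∀ a b c → ¬ Independent3 G a b c) →
                     ∀ z → IsClique G (NonNbhd G z)
  nonNbhd-isClique noInd3 z u v (u≢z , ¬zu) (v≢z , ¬zv) u≢v with adj? u v
  ... | yes uv = uv
  ... | no ¬uv = ⊥-elim (noInd3 z u v (≢-sym u≢z , ≢-sym v≢z , u≢v , ¬zu , ¬zv , ¬uv))

  pair-isClique : ∀ {x y} → Adj x y → IsClique G (λ v → v ≡ x ⊎ v ≡ y)
  pair-isClique xy _ _ (inj₁ refl) (inj₁ refl) u≢v = ⊥-elim (u≢v refl)
  pair-isClique xy _ _ (inj₁ refl) (inj₂ refl) _   = xy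
  pair-isClique xy _ _ (inj₂ refl) (inj₁ refl) _   = adj-sym xy
  pair-isClique xy _ _ (inj₂ refl) (inj₂ refl) u≢v = ⊥-elim (u≢v refl)

  dominatingEdge⇒adj-nonNbhd : ∀ {z w v} → DominatingEdge G z w → NonNbhd G z v → Adj w v
  dominatingEdge⇒adj-nonNbhd {z} (zw , dom) (v≢z , ¬zv)
    with dom _ v≢z (λ { refl → ¬zv zw })
  ... | inj₁ zv = ⊥-elim (¬zv zv)
  ... | inj₂ wv = wv

  extension-adj⇒dominatingEdge : ∀ {z S w} → IsExtension G z S → ExtSet G z S w →
                                 Adj z w → DominatingEdge G z w
  extension-adj⇒dominatingEdge {z} {w = w} (_ , clique) w∈ zw = zw , dom
    where
    dom : ∀ v → v ≢ z → v ≢ w → Adj z v ⊎ Adj w v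
    dom v v≢z v≢w with adj? z v
    ... | yes zv = inj₁ zv
    ... | no ¬zv = inj₂ (clique w v w∈ (inj₁ (v≢z , ¬zv)) (≢-sym v≢w))

  dominatingClique⇒extension : (∀ a b c → ¬ Independent3 G a b c) → ∀ {z S} →
                               (∀ w → w ∈ S → DominatingEdge G z w) →
                               IsClique G (_∈ S) → IsExtension G z S
  dominatingClique⇒extension noInd3 {z} {S} dom clique = (λ w w∈ → proj₁ (dom w w∈)) , extClique
    where
    extClique : IsClique G (ExtSet G z S)
    extClique u v (inj₁ u∉) (inj₁ v∉) = nonNbhd-isClique noInd3 z u v u∉ v∉
    extClique u v (inj₁ u∉) (inj₂ v∈) _ = adj-sym (dominatingEdge⇒adj-nonNbhd (dom v v∈) u∉)
    extClique u v (inj₂ u∈) (inj₁ v∉) _ = dominatingEdge⇒adj-nonNbhd (dom u u∈) v∉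
    extClique u v (inj₂ u∈) (inj₂ v∈) = clique u v u∈ v∈

  DominatesIfAdjacent : Fin n → Fin n → Set
  DominatesIfAdjacent z w = Adj z w → DominatingEdge G z w

  ExtensionContaining : Fin n → Fin n → Fin n → Set
  ExtensionContaining z x y = Σ (Subset n) λ S → IsExtension G z S × ExtSet G z S x × ExtSet G z S y

  extensionContaining⇔ : (∀ a b c → ¬ Independent3 G a b c) → ∀ {x y z} →
                         Adj x y → z ≢ x → z ≢ y →
                         ExtensionContaining z x y ⇔ (DominatesIfAdjacent z x × DominatesIfAdjacent z y)
  extensionContaining⇔ noInd3 {x} {y} {z} xy z≢x z≢y = mk⇔ to from
    where
    to : ExtensionContaining z x y → DominatesIfAdjacent z x × DominatesIfAdjacent z y
    to (S , ext , x∈ , y∈) =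
      extension-adj⇒dominatingEdge ext x∈ , extension-adj⇒dominatingEdge ext y∈

    InPair : Fin n → Set
    InPair v = v ≡ x ⊎ v ≡ y

    -- Only those of x, y adjacent to z go into S: the others already lie in NonNbhd z.
    InS? : ∀ v → Dec (InPair v × Adj z v)
    InS? v = ((v ≟ x) ⊎-dec (v ≟ y)) ×-dec adj? z v

    S : Subset n
    S = subsetOf InS?

    ∈ExtSet : ∀ {w} → InPair w → z ≢ w → ExtSet G z S w
    ∈ExtSet {w} w∈pair z≢w with adj? z w
    ... | yes zw = inj₂ (∈-subsetOf⁺ InS? (w∈pair , zw))
    ... | no ¬zw = inj₁ (≢-sym z≢w , ¬zw)

    from : DominatesIfAdjacent z x × DominatesIfAdjacent z y → ExtensionContaining z x y
    from (domX , domY) =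
      S , dominatingClique⇒extension noInd3 dominating clique ,
      ∈ExtSet (inj₁ refl) z≢x , ∈ExtSet (inj₂ refl) z≢y
      where
      dominating : ∀ w → w ∈ S → DominatingEdge G z w
      dominating w w∈ with ∈-subsetOf⁻ InS? w∈
      ... | inj₁ refl , zw = domX zw
      ... | inj₂ refl , zw = domY zw
      clique : IsClique G (_∈ S)
      clique u v u∈ v∈ =
        pair-isClique xy u v (proj₁ (∈-subsetOf⁻ InS? u∈)) (proj₁ (∈-subsetOf⁻ InS? v∈))

  DominatingCases : Fin n → Fin n → Fin n → Set
  DominatingCases z x y = (DominatingEdge G z x × ¬ Adj z y)
                        ⊎ (DominatingEdge G z y × ¬ Adj z x)
                        ⊎ (DominatingEdge G z x × DominatingEdge G z y)

  cases⇔dominatesIfAdjacent : ∀ {x y z} → Adj z x ⊎ Adj z y →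
                              DominatingCases z x y ⇔ (DominatesIfAdjacent z x × DominatesIfAdjacent z y)
  cases⇔dominatesIfAdjacent {x} {y} {z} zx⊎zy = mk⇔ to from
    where
    to : DominatingCases z x y → DominatesIfAdjacent z x × DominatesIfAdjacent z y
    to (inj₁ (domX , ¬zy))        = (λ _ → domX) , (λ zy → ⊥-elim (¬zy zy))
    to (inj₂ (inj₁ (domY , ¬zx))) = (λ zx → ⊥-elim (¬zx zx)) , (λ _ → domY)
    to (inj₂ (inj₂ (domX , domY))) = (λ _ → domX) , (λ _ → domY)

    from : DominatesIfAdjacent z x × DominatesIfAdjacent z y → DominatingCases z x y
    from (domX , domY) with adj? z x | adj? z y
    ... | yes zx | yes zy = inj₂ (inj₂ (domX zx , domY zy))
    ... | yes zx | no ¬zy = inj₁ (domX zx , ¬zy)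
    ... | no ¬zx | yes zy = inj₂ (inj₁ (domY zy , ¬zx))
    ... | no ¬zx | no ¬zy = ⊥-elim ([ ¬zx , ¬zy ]′ zx⊎zy)

lemma15 : ∀ {n : ℕ} (G : Graph n) → Alpha2 G →
          (x y z : Fin n) → DominatingEdge G x y → z ≢ x → z ≢ y →
          (Σ (Subset n) λ S → IsExtension G z S × ExtSet G z S x × ExtSet G z S y)
          ⇔ ((DominatingEdge G z x × ¬ Graph.Adj G z y)
             ⊎ (DominatingEdge G z y × ¬ Graph.Adj G z x)
             ⊎ (DominatingEdge G z x × DominatingEdge G z y))
lemma15 G (_ , noInd3) x y z (xy , domXY) z≢x z≢y =
  ⇔.trans (extensionContaining⇔ G noInd3 xy z≢x z≢y)
          (⇔.sym (cases⇔dominatesIfAdjacent G zx⊎zy))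
  where
  open Graph G renaming (sym to adj-sym)
  zx⊎zy : Adj z x ⊎ Adj z y
  zx⊎zy = ⊎-map adj-sym adj-sym (domXY z z≢x z≢y)
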